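{- Let $\mathbf A=(A,\le)$ be an MLUB-complete poset and $M$ a nonempty subset of $A$. Then (i) $U(\operatorname{Max}L(M))=UL(M)$ and (ii) $L(\operatorname{Min}U(M))=LU(M)$.
   Context: For $X\subseteq A$: $L(X)=\{a\in A\mid a\le x\ \forall x\in X\}$, $U(X)=\{a\in A\mid x\le a\ \forall x\in X\}$, $UL(X)=U(L(X))$, $LU(X)=L(U(X))$; $\operatorname{Max}X,\operatorname{Min}X$ are the sets of maximal/minimal elements of $X$. $\mathbf A$ is MLUB-complete if for every nonempty $N\subseteq A$, every upper bound of $N$ lies above some minimal upper bound of $N$, and every lower bound of $N$ lies below some maximal lower bound of $N$. -}

module Defs where

open import Level using (Level; _⊔_; suc)
open import Data.Product using (Σ; _×_; ∃; _,_)
open import Relation.Unary using (Pred; _∈_; _⊆_; _≐_)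
open import Relation.Binary.Bundles using (Poset)

module PosetDefs {c ℓ₁ ℓ₂ : Level} (P : Poset c ℓ₁ ℓ₂) where
  open Poset P

  L : ∀ {ℓ} → Pred Carrier ℓ → Pred Carrier (c ⊔ ℓ ⊔ ℓ₂)
  L X a = ∀ x → x ∈ X → a ≤ x

  U : ∀ {ℓ} → Pred Carrier ℓ → Pred Carrier (c ⊔ ℓ ⊔ ℓ₂)
  U X a = ∀ x → x ∈ X → x ≤ a

  Max : ∀ {ℓ} → Pred Carrier ℓ → Pred Carrier (c ⊔ ℓ ⊔ ℓ₁ ⊔ ℓ₂)
  Max X a = a ∈ X × (∀ y → y ∈ X → a ≤ y → a ≈ y)

  Min : ∀ {ℓ} → Pred Carrier ℓ → Pred Carrier (c ⊔ ℓ ⊔ ℓ₁ ⊔ ℓ₂)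
  Min X a = a ∈ X × (∀ y → y ∈ X → y ≤ a → a ≈ y)

  NonEmpty : ∀ {ℓ} → Pred Carrier ℓ → Set (c ⊔ ℓ)
  NonEmpty X = ∃ λ x → x ∈ X

MLUB-complete : ∀ {c ℓ₁ ℓ₂} (P : Poset c ℓ₁ ℓ₂) (ℓ : Level) → Set (c ⊔ ℓ₁ ⊔ ℓ₂ ⊔ suc ℓ)
MLUB-complete P ℓ =
  (N : Pred Carrier ℓ) → NonEmpty N →
    ((b : Carrier) → b ∈ U N → ∃ λ m → m ∈ Min (U N) × m ≤ b)
  × ((b : Carrier) → b ∈ L N → ∃ λ m → m ∈ Max (L N) × b ≤ m)
  where open Poset P
        open PosetDefs P

{-# OPTIONS --safe #-}
module Submission where

open import Defs
open import Level using (Level)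
open import Data.Product using (_×_; _,_; proj₁; proj₂; ∃)
open import Relation.Unary using (Pred; _∈_; _⊆_; _≐_)
open import Relation.Binary.Bundles using (Poset)

module _ {c ℓ₁ ℓ₂ : Level} (P : Poset c ℓ₁ ℓ₂) where
  open Poset P
  open PosetDefs P

  private
    variable
      ℓ ℓ′ : Level
      X : Pred Carrier ℓ
      Y : Pred Carrier ℓ′

  U-antitone : X ⊆ Y → U Y ⊆ U X
  U-antitone X⊆Y a∈UY x x∈X = a∈UY x (X⊆Y x∈X)

  L-antitone : X ⊆ Y → L Y ⊆ L X
  L-antitone X⊆Y a∈LY x x∈X = a∈LY x (X⊆Y x∈X)

  U-Max≐U : (∀ x → x ∈ X → ∃ λ m → m ∈ Max X × x ≤ m) → U (Max X) ≐ U X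
  U-Max≐U belowMax =
      (λ a∈UMax x x∈X → let m , m∈Max , x≤m = belowMax x x∈X
                        in trans x≤m (a∈UMax m m∈Max))
    , U-antitone proj₁

  L-Min≐L : (∀ x → x ∈ X → ∃ λ m → m ∈ Min X × m ≤ x) → L (Min X) ≐ L X
  L-Min≐L aboveMin =
      (λ a∈LMin x x∈X → let m , m∈Min , m≤x = aboveMin x x∈X
                        in trans (a∈LMin m m∈Min) m≤x)
    , L-antitone proj₁

lemma2p3 : ∀ {c ℓ₁ ℓ₂ ℓ} (P : Poset c ℓ₁ ℓ₂) → (∀ ℓ′ → MLUB-complete P ℓ′) →
    (M : Pred (Poset.Carrier P) ℓ) → PosetDefs.NonEmpty P M →
    (PosetDefs.U P (PosetDefs.Max P (PosetDefs.L P M)) ≐ PosetDefs.U P (PosetDefs.L P M))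
    × (PosetDefs.L P (PosetDefs.Min P (PosetDefs.U P M)) ≐ PosetDefs.L P (PosetDefs.U P M))
lemma2p3 {ℓ = ℓ} P complete M M≢∅ =
  U-Max≐U P (proj₂ (complete ℓ M M≢∅)) , L-Min≐L P (proj₁ (complete ℓ M M≢∅))
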